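{- For integers $n > r \geq 1$, let $p_{n,r}$ denote the word $(\,0^{n-r-1}\,)\,0^{r-1}$ of length $n$ (a left parenthesis, then $n-r-1$ zeros, then a right parenthesis, then $r-1$ zeros). Then $p_{n,r}$ belongs to the Motzkin row $\mathfrak{M}$, and its index (weight) in $\mathfrak{M}$ is $$\operatorname{wt} p_{n,r} = M_{n-1} + M_{r+1} - M_r - M_{r-1}.$$
   Context: A Motzkin word of length $n\ge 0$ is a string over the alphabet $\{0, (, )\}$ in which the numbers of left and right parentheses are equal and in every prefix the number of left parentheses is at least the number of right parentheses (a word may consist only of zeros; the empty word is the unique word of length $0$). $M_n$ denotes the number of Motzkin words of length $n$ (Motzkin numbers: $M_0=1, M_1=1, M_2=2, M_3=4, M_4=9,\dots$). The Motzkin row $\mathfrak{M}$ is the set consisting of the word "$0$" together with all Motzkin words of length $n\ge 2$ that begin with a left parenthesis, totally ordered as follows: first by length (shorter words first), and words of equal length are ordered lexicographically with respect to the alphabet order $0 < ( < )$. The elements of $\mathfrak{M}$ are indexed $0,1,2,\dots$ in this order (so "$0$" has index $0$, "$()$" has index $1$, "$(0)$" index $2$, "$()0$" index $3$, ...); the index of $x\in\mathfrak{M}$ is called its weight $\operatorname{wt} x$. Powers denote repetition, e.g. $0^3 = 000$. -}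

module Defs where

open import Data.Nat using (ℕ; zero; suc; _+_; _∸_; _≤_; _<_)
open import Data.Bool using (Bool; true; false; _∧_; _∨_; if_then_else_)
open import Data.List using (List; []; _∷_; length; filter; map; concatMap; replicate; _++_)
open import Data.Maybe using (Maybe; just; nothing)
open import Relation.Binary.PropositionalEquality using (_≡_)
open import Relation.Nullary using (¬_)
open import Data.Product using (_×_)
open import Data.Sum using (_⊎_)

-- Alphabet {0, (, )} with order 0 < ( < )
data Sym : Set where
  o  : Sym
  lp : Sym
  rp : Sym

Word : Set
Word = List Sym

symLt : Sym → Sym → Bool
symLt o lp  = true
symLt o rp  = true
symLt lp rp = true
symLt _ _   = false

symEq : Sym → Sym → Bool
symEq o o   = true
symEq lp lp = true
symEq rp rp = true
symEq _ _   = false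

-- Motzkin check: running balance (current excess of '(' over ')')
-- never negative, and zero at the end.
motzkinFrom : ℕ → Word → Bool
motzkinFrom zero    []        = true
motzkinFrom (suc _) []        = false
motzkinFrom k       (o ∷ w)   = motzkinFrom k w
motzkinFrom k       (lp ∷ w)  = motzkinFrom (suc k) w
motzkinFrom zero    (rp ∷ w)  = false
motzkinFrom (suc k) (rp ∷ w)  = motzkinFrom k w

IsMotzkin : Word → Set
IsMotzkin w = motzkinFrom 0 w ≡ true

allWords : ℕ → List Word
allWords zero    = [] ∷ []
allWords (suc n) = concatMap (λ w → (o ∷ w) ∷ (lp ∷ w) ∷ (rp ∷ w) ∷ []) (allWords n)

M : ℕ → ℕ
M n = length (filter (λ w → Data.Bool._≟_ (motzkinFrom 0 w) true) (allWords n))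

inRowB : Word → Bool
inRowB (o ∷ [])          = true
inRowB (lp ∷ [])         = false
inRowB (lp ∷ x ∷ w)      = motzkinFrom 0 (lp ∷ x ∷ w)
inRowB _                 = false

InRow : Word → Set
InRow w = inRowB w ≡ true

-- lexicographic strict order for words (used on words of equal length)
lexLt : Word → Word → Bool
lexLt []      []      = false
lexLt []      (_ ∷ _) = true
lexLt (_ ∷ _) []      = false
lexLt (a ∷ u) (b ∷ v) = symLt a b ∨ (symEq a b ∧ lexLt u v)

ltNat : ℕ → ℕ → Bool
ltNat _       zero    = false
ltNat zero    (suc _) = true
ltNat (suc m) (suc n) = ltNat m n

eqNat : ℕ → ℕ → Bool
eqNat zero    zero    = true
eqNat (suc m) (suc n) = eqNat m n
eqNat _       _       = false

rowLt : Word → Word → Bool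
rowLt u v = ltNat (length u) (length v) ∨ (eqNat (length u) (length v) ∧ lexLt u v)

wordsUpTo : ℕ → List Word
wordsUpTo zero    = allWords 0
wordsUpTo (suc n) = wordsUpTo n ++ allWords (suc n)

-- weight (index) of x in the row: the number of row elements strictly
-- smaller than x (all of them have length ≤ length x).
wt : Word → ℕ
wt x = length (filter (λ y → Data.Bool._≟_ (inRowB y ∧ rowLt y x) true) (wordsUpTo (length x)))

p : ℕ → ℕ → Word
p n r = lp ∷ replicate (n ∸ r ∸ 1) o ++ rp ∷ replicate (r ∸ 1) o

-- Let Mfrom k n count the words of length n that stay balanced when started at height k, so M = Mfrom 0.
-- Write p = ( 0^a ) 0^s with r = s + 1 and n = r + a + 1.  The row elements shorter than p are the
-- word 0 and the words ( w with w balanced from height 1; by M (m + 1) = M m + Mfrom 1 m they number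
-- M (n - 1).  A row element ( w of length n precedes p iff w lies below 0^a ) 0^s, i.e. w = 0^a x v
-- with x ∈ {0, (}, so there are Mfrom 1 s + Mfrom 2 s of them.  Finally
-- Mfrom 1 (s + 1) = Mfrom 1 s + Mfrom 2 s + M s turns M (r + 1) - M r - M (r - 1) into that sum.
module Submission where

open import Defs
open import Data.Nat using (ℕ; zero; suc; _+_; _∸_; _≤_; _<_; s≤s)
open import Data.Nat.Properties
  using (+-identityʳ; +-assoc; +-suc; +-comm; m+n∸m≡n; m≤n⇒∃[o]m+o≡n; ≤-reflexive; m≤n⇒m≤1+n)
open import Data.Nat.Solver using (module +-*-Solver)
open import Data.Bool using (Bool; true; false; _∧_; _≟_)
open import Data.Bool.Properties using (∧-zeroʳ; ∧-identityʳ)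
open import Data.List using (List; []; _∷_; [_]; length; filter; concatMap; replicate; _++_)
open import Data.List.Properties using (filter-++; length-++; length-replicate)
open import Data.List.Relation.Unary.All as All using (All; []; _∷_)
open import Data.List.Relation.Unary.All.Properties using (++⁺; concat⁺; map⁺)
open import Data.Product using (_×_; _,_)
open import Function using (_∘_)
open import Relation.Binary.PropositionalEquality
  using (_≡_; _≗_; refl; sym; trans; cong; cong₂; subst; module ≡-Reasoning)
open +-*-Solver using (solve; _:+_; _:=_)
open ≡-Reasoning

count : {A : Set} → (A → Bool) → List A → ℕ
count f xs = length (filter (λ x → f x ≟ true) xs)

count-++ : {A : Set} (f : A → Bool) (xs ys : List A) →
           count f (xs ++ ys) ≡ count f xs + count f ys
count-++ f xs ys = trans (cong length (filter-++ _ xs ys)) (length-++ (filter _ xs))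

count-cong : {A : Set} {f g : A → Bool} {xs : List A} →
             All (λ x → f x ≡ g x) xs → count f xs ≡ count g xs
count-cong {xs = []}     []        = refl
count-cong {f = f} {g} {x ∷ xs} (eq ∷ eqs) with f x | g x | eq
... | true  | .true  | refl = cong suc (count-cong eqs)
... | false | .false | refl = count-cong eqs

count-false : {A : Set} (xs : List A) → count (λ _ → false) xs ≡ 0
count-false []       = refl
count-false (_ ∷ xs) = count-false xs

count-≗ : {A : Set} {f g : A → Bool} (xs : List A) → f ≗ g → count f xs ≡ count g xs
count-≗ xs f≗g = count-cong (All.universal f≗g xs)

count-none : {A : Set} {f : A → Bool} {xs : List A} →
             All (λ x → f x ≡ false) xs → count f xs ≡ 0
count-none {xs = xs} none = trans (count-cong none) (count-false xs)

count-[]-∘ : {A B : Set} (f : B → Bool) (g : A → B) (x : A) →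
             count (f ∘ g) [ x ] ≡ count f [ g x ]
count-[]-∘ f g x with f (g x)
... | true  = refl
... | false = refl

extensions : Word → List Word
extensions w = (o ∷ w) ∷ (lp ∷ w) ∷ (rp ∷ w) ∷ []

allWords-length : ∀ n → All (λ w → length w ≡ n) (allWords n)
allWords-length zero    = refl ∷ []
allWords-length (suc n) =
  concat⁺ (map⁺ (All.map (λ eq → cong suc eq ∷ cong suc eq ∷ cong suc eq ∷ [])
                          (allWords-length n)))

wordsUpTo-length : ∀ n → All (λ w → length w ≤ n) (wordsUpTo n)
wordsUpTo-length zero    = All.map ≤-reflexive (allWords-length zero)
wordsUpTo-length (suc n) =
  ++⁺ (All.map m≤n⇒m≤1+n (wordsUpTo-length n)) (All.map ≤-reflexive (allWords-length (suc n)))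

count-allWords-suc : ∀ (f : Word → Bool) n →
  count f (allWords (suc n)) ≡
  count (f ∘ (o ∷_)) (allWords n) + count (f ∘ (lp ∷_)) (allWords n)
    + count (f ∘ (rp ∷_)) (allWords n)
count-allWords-suc f n = go (allWords n)
  where
  go : ∀ ws → count f (concatMap extensions ws) ≡
              count (f ∘ (o ∷_)) ws + count (f ∘ (lp ∷_)) ws + count (f ∘ (rp ∷_)) ws
  go []       = refl
  go (w ∷ ws) = begin
    count f (extensions w ++ concatMap extensions ws)
      ≡⟨ count-++ f (extensions w) (concatMap extensions ws) ⟩
    count f (extensions w) + count f (concatMap extensions ws)
      ≡⟨ cong₂ _+_ (trans (count-++ f [ o ∷ w ] _) (cong (x +_) (count-++ f [ lp ∷ w ] _)))
                   (go ws) ⟩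
    (x + (y + z)) + (count fo ws + count fl ws + count fr ws)
      ≡⟨ solve 6 (λ x y z X Y Z → (x :+ (y :+ z)) :+ (X :+ Y :+ Z)
                                 := (x :+ X) :+ (y :+ Y) :+ (z :+ Z))
               refl x y z (count fo ws) (count fl ws) (count fr ws) ⟩
    (x + count fo ws) + (y + count fl ws) + (z + count fr ws)
      ≡⟨ cong₂ _+_ (cong₂ _+_ (step (o ∷_)) (step (lp ∷_))) (step (rp ∷_)) ⟨
    count fo (w ∷ ws) + count fl (w ∷ ws) + count fr (w ∷ ws) ∎
    where
    step : (h : Word → Word) → count (f ∘ h) (w ∷ ws) ≡ count f [ h w ] + count (f ∘ h) ws
    step h = trans (count-++ (f ∘ h) [ w ] ws) (cong (_+ count (f ∘ h) ws) (count-[]-∘ f h w))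
    fo = f ∘ (o ∷_)
    fl = f ∘ (lp ∷_)
    fr = f ∘ (rp ∷_)
    x = count f [ o ∷ w ]
    y = count f [ lp ∷ w ]
    z = count f [ rp ∷ w ]

Mfrom : ℕ → ℕ → ℕ
Mfrom k n = count (motzkinFrom k) (allWords n)

motzkinFrom-o∷ : ∀ k w → motzkinFrom k (o ∷ w) ≡ motzkinFrom k w
motzkinFrom-o∷ zero    w = refl
motzkinFrom-o∷ (suc k) w = refl

motzkinFrom-lp∷ : ∀ k w → motzkinFrom k (lp ∷ w) ≡ motzkinFrom (suc k) w
motzkinFrom-lp∷ zero    w = refl
motzkinFrom-lp∷ (suc k) w = refl

M-suc : ∀ n → M (suc n) ≡ M n + Mfrom 1 n
M-suc n = begin
  M (suc n)                                            ≡⟨ count-allWords-suc (motzkinFrom 0) n ⟩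
  M n + Mfrom 1 n + count (λ _ → false) (allWords n)
    ≡⟨ cong (M n + Mfrom 1 n +_) (count-false (allWords n)) ⟩
  M n + Mfrom 1 n + 0                                  ≡⟨ +-identityʳ _ ⟩
  M n + Mfrom 1 n                                      ∎

Mfrom-suc : ∀ k n → Mfrom (suc k) (suc n) ≡ Mfrom (suc k) n + Mfrom (suc (suc k)) n + Mfrom k n
Mfrom-suc k n = count-allWords-suc (motzkinFrom (suc k)) n

M-suc-suc : ∀ n → M (suc (suc n)) ≡ M (suc n) + (Mfrom 1 n + Mfrom 2 n) + M n
M-suc-suc n = begin
  M (suc (suc n))                              ≡⟨ M-suc (suc n) ⟩
  M (suc n) + Mfrom 1 (suc n)                  ≡⟨ cong (M (suc n) +_) (Mfrom-suc 0 n) ⟩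
  M (suc n) + (Mfrom 1 n + Mfrom 2 n + M n)    ≡⟨ +-assoc (M (suc n)) _ (M n) ⟨
  M (suc n) + (Mfrom 1 n + Mfrom 2 n) + M n    ∎

inRowB-lp∷ : ∀ w → inRowB (lp ∷ w) ≡ motzkinFrom 1 w
inRowB-lp∷ []       = refl
inRowB-lp∷ (_ ∷ _) = refl

inRowB-o∷ : ∀ w {n} → length w ≡ suc n → inRowB (o ∷ w) ≡ false
inRowB-o∷ (_ ∷ _) _ = refl

row-count : ∀ n → count inRowB (wordsUpTo (suc n)) ≡ M (suc n)
row-count zero    = refl
row-count (suc n) = begin
  count inRowB (wordsUpTo (suc n) ++ allWords (suc (suc n)))
    ≡⟨ count-++ inRowB (wordsUpTo (suc n)) _ ⟩
  count inRowB (wordsUpTo (suc n)) + count inRowB (allWords (suc (suc n)))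
    ≡⟨ cong₂ _+_ (row-count n) longRows ⟩
  M (suc n) + Mfrom 1 (suc n)
    ≡⟨ M-suc (suc n) ⟨
  M (suc (suc n)) ∎
  where
  longRows : count inRowB (allWords (suc (suc n))) ≡ Mfrom 1 (suc n)
  longRows = begin
    count inRowB (allWords (suc (suc n)))
      ≡⟨ count-allWords-suc inRowB (suc n) ⟩
    count (inRowB ∘ (o ∷_)) ws + count (inRowB ∘ (lp ∷_)) ws + count (λ _ → false) ws
      ≡⟨ cong₂ _+_ (cong₂ _+_ (count-none (All.map (λ {w} → inRowB-o∷ w) (allWords-length (suc n))))
                              (count-≗ ws inRowB-lp∷))
                   (count-false ws) ⟩
    0 + Mfrom 1 (suc n) + 0
      ≡⟨ +-identityʳ _ ⟩
    Mfrom 1 (suc n) ∎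
    where
    ws = allWords (suc n)

ltNat-< : ∀ {m n} → m < n → ltNat m n ≡ true
ltNat-< {zero}  {suc _} _         = refl
ltNat-< {suc m} {suc n} (s≤s m<n) = ltNat-< m<n

ltNat-irrefl : ∀ n → ltNat n n ≡ false
ltNat-irrefl zero    = refl
ltNat-irrefl (suc n) = ltNat-irrefl n

eqNat-refl : ∀ n → eqNat n n ≡ true
eqNat-refl zero    = refl
eqNat-refl (suc n) = eqNat-refl n

rowLt-shorter : ∀ u v → length u < length v → rowLt u v ≡ true
rowLt-shorter _ _ u<v rewrite ltNat-< u<v = refl

rowLt-sameLength : ∀ u v → length u ≡ length v → rowLt u v ≡ lexLt u v
rowLt-sameLength u v eq rewrite eq | ltNat-irrefl (length v) | eqNat-refl (length v) = refl

wt-∷ : ∀ x v →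
  wt (x ∷ v) ≡ count inRowB (wordsUpTo (length v))
             + count (λ w → inRowB w ∧ lexLt w (x ∷ v)) (allWords (suc (length v)))
wt-∷ x v = begin
  count below (wordsUpTo ℓ ++ allWords (suc ℓ))
    ≡⟨ count-++ below (wordsUpTo ℓ) (allWords (suc ℓ)) ⟩
  count below (wordsUpTo ℓ) + count below (allWords (suc ℓ))
    ≡⟨ cong₂ _+_ (count-cong (All.map (λ {w} → shorter w) (wordsUpTo-length ℓ)))
                 (count-cong (All.map (λ {w} → sameLength w) (allWords-length (suc ℓ)))) ⟩
  count inRowB (wordsUpTo ℓ) + count (λ w → inRowB w ∧ lexLt w (x ∷ v)) (allWords (suc ℓ)) ∎
  where
  ℓ = length v
  below : Word → Bool
  below w = inRowB w ∧ rowLt w (x ∷ v)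
  shorter : ∀ w → length w ≤ ℓ → below w ≡ inRowB w
  shorter w w≤ℓ =
    trans (cong (inRowB w ∧_) (rowLt-shorter w (x ∷ v) (s≤s w≤ℓ))) (∧-identityʳ (inRowB w))
  sameLength : ∀ w → length w ≡ suc ℓ → below w ≡ (inRowB w ∧ lexLt w (x ∷ v))
  sameLength w eq = cong (inRowB w ∧_) (rowLt-sameLength w (x ∷ v) eq)

closing : ℕ → ℕ → Word
closing a s = replicate a o ++ rp ∷ replicate s o

length-closing : ∀ a s → length (closing a s) ≡ a + suc s
length-closing a s =
  trans (length-++ (replicate a o)) (cong₂ _+_ (length-replicate a) (cong suc (length-replicate s)))

lexLt-replicate-o : ∀ w → lexLt w (replicate (length w) o) ≡ false
lexLt-replicate-o []       = refl
lexLt-replicate-o (o ∷ w)  = lexLt-replicate-o w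
lexLt-replicate-o (lp ∷ w) = refl
lexLt-replicate-o (rp ∷ w) = refl

count-below-closing : ∀ k a s →
  count (λ w → motzkinFrom k w ∧ lexLt w (closing a s)) (allWords (a + suc s))
    ≡ Mfrom k s + Mfrom (suc k) s
count-below-closing k zero s = begin
  count (λ w → motzkinFrom k w ∧ lexLt w (closing zero s)) (allWords (suc s))
    ≡⟨ count-allWords-suc _ s ⟩
  count (λ w → motzkinFrom k (o ∷ w) ∧ true) ws
    + count (λ w → motzkinFrom k (lp ∷ w) ∧ true) ws
    + count (λ w → motzkinFrom k (rp ∷ w) ∧ lexLt w (replicate s o)) ws
    ≡⟨ cong₂ _+_ (cong₂ _+_ (count-≗ ws (λ w → trans (∧-identityʳ _) (motzkinFrom-o∷ k w)))
                            (count-≗ ws (λ w → trans (∧-identityʳ _) (motzkinFrom-lp∷ k w))))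
                 (count-none (All.map notBelowZeros (allWords-length s))) ⟩
  Mfrom k s + Mfrom (suc k) s + 0
    ≡⟨ +-identityʳ _ ⟩
  Mfrom k s + Mfrom (suc k) s ∎
  where
  ws = allWords s
  notBelowZeros : ∀ {w} → length w ≡ s → motzkinFrom k (rp ∷ w) ∧ lexLt w (replicate s o) ≡ false
  notBelowZeros {w} refl =
    trans (cong (motzkinFrom k (rp ∷ w) ∧_) (lexLt-replicate-o w)) (∧-zeroʳ _)
count-below-closing k (suc a) s = begin
  count (λ w → motzkinFrom k w ∧ lexLt w (closing (suc a) s)) (allWords (suc (a + suc s)))
    ≡⟨ count-allWords-suc _ (a + suc s) ⟩
  count (λ w → motzkinFrom k (o ∷ w) ∧ lexLt w (closing a s)) ws
    + count (λ w → motzkinFrom k (lp ∷ w) ∧ false) ws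
    + count (λ w → motzkinFrom k (rp ∷ w) ∧ false) ws
    ≡⟨ cong₂ _+_ (cong₂ _+_ (count-≗ ws (λ w → cong (_∧ lexLt w (closing a s)) (motzkinFrom-o∷ k w)))
                            (count-none (All.universal (λ w → ∧-zeroʳ (motzkinFrom k (lp ∷ w))) ws)))
                 (count-none (All.universal (λ w → ∧-zeroʳ (motzkinFrom k (rp ∷ w))) ws)) ⟩
  count (λ w → motzkinFrom k w ∧ lexLt w (closing a s)) ws + 0 + 0
    ≡⟨ trans (+-identityʳ _) (+-identityʳ _) ⟩
  count (λ w → motzkinFrom k w ∧ lexLt w (closing a s)) ws
    ≡⟨ count-below-closing k a s ⟩
  Mfrom k s + Mfrom (suc k) s ∎
  where
  ws = allWords (a + suc s)

rowWords-below-closing : ∀ a s →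
  count (λ w → inRowB w ∧ lexLt w (lp ∷ closing a s)) (allWords (suc (length (closing a s))))
    ≡ Mfrom 1 s + Mfrom 2 s
rowWords-below-closing a s = begin
  count (λ w → inRowB w ∧ lexLt w (lp ∷ closing a s)) (allWords (suc ℓ))
    ≡⟨ count-allWords-suc _ ℓ ⟩
  count (λ w → inRowB (o ∷ w) ∧ true) (allWords ℓ)
    + count (λ w → inRowB (lp ∷ w) ∧ lexLt w (closing a s)) (allWords ℓ)
    + count (λ _ → false) (allWords ℓ)
    ≡⟨ cong₂ _+_ (cong₂ _+_ (count-none (All.map (λ {w} → notInRow w) (allWords-length ℓ)))
                            (count-≗ (allWords ℓ) (λ w → cong (_∧ lexLt w (closing a s)) (inRowB-lp∷ w))))
                 (count-false (allWords ℓ)) ⟩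
  0 + count below (allWords ℓ) + 0
    ≡⟨ +-identityʳ _ ⟩
  count below (allWords ℓ)
    ≡⟨ cong (count below ∘ allWords) (length-closing a s) ⟩
  count below (allWords (a + suc s))
    ≡⟨ count-below-closing 1 a s ⟩
  Mfrom 1 s + Mfrom 2 s ∎
  where
  ℓ = length (closing a s)
  below : Word → Bool
  below w = motzkinFrom 1 w ∧ lexLt w (closing a s)
  notInRow : ∀ w → length w ≡ ℓ → inRowB (o ∷ w) ∧ true ≡ false
  notInRow w eq = cong (_∧ true) (inRowB-o∷ w (trans eq (trans (length-closing a s) (+-suc a s))))

wt-closing : ∀ a s → wt (lp ∷ closing a s) ≡ M (suc s + a) + (Mfrom 1 s + Mfrom 2 s)
wt-closing a s = begin
  wt (lp ∷ closing a s)
    ≡⟨ wt-∷ lp (closing a s) ⟩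
  count inRowB (wordsUpTo ℓ) + count (λ w → inRowB w ∧ lexLt w (lp ∷ closing a s)) (allWords (suc ℓ))
    ≡⟨ cong₂ _+_ (cong (count inRowB ∘ wordsUpTo) (trans (length-closing a s) (+-comm a (suc s))))
                 (rowWords-below-closing a s) ⟩
  count inRowB (wordsUpTo (suc s + a)) + (Mfrom 1 s + Mfrom 2 s)
    ≡⟨ cong (_+ (Mfrom 1 s + Mfrom 2 s)) (row-count (s + a)) ⟩
  M (suc s + a) + (Mfrom 1 s + Mfrom 2 s) ∎
  where
  ℓ = length (closing a s)

closing-InRow : ∀ a s → InRow (lp ∷ closing a s)
closing-InRow a s = trans (inRowB-lp∷ (closing a s)) (motzkin a)
  where
  zeros : ∀ s → motzkinFrom 0 (replicate s o) ≡ true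
  zeros zero    = refl
  zeros (suc s) = zeros s
  motzkin : ∀ a → motzkinFrom 1 (closing a s) ≡ true
  motzkin zero    = zeros s
  motzkin (suc a) = motzkin a

p-closing : ∀ s a → p (suc (suc s + a)) (suc s) ≡ lp ∷ closing a s
p-closing s a = cong (λ k → lp ∷ closing k s) zerosBetween
  where
  zerosBetween : suc (s + a) ∸ s ∸ 1 ≡ a
  zerosBetween = cong (_∸ 1) (trans (cong (_∸ s) (sym (+-suc s a))) (m+n∸m≡n s (suc a)))

wt-closing-identity : ∀ a s →
  wt (lp ∷ closing a s) + M (suc s) + M s ≡ M (suc s + a) + M (suc s + 1)
wt-closing-identity a s = begin
  wt (lp ∷ closing a s) + M (suc s) + M s
    ≡⟨ cong (λ w → w + M (suc s) + M s) (wt-closing a s) ⟩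
  M (suc s + a) + (Mfrom 1 s + Mfrom 2 s) + M (suc s) + M s
    ≡⟨ solve 5 (λ X A B Y Z → X :+ (A :+ B) :+ Y :+ Z := X :+ (Y :+ (A :+ B) :+ Z))
             refl (M (suc s + a)) (Mfrom 1 s) (Mfrom 2 s) (M (suc s)) (M s) ⟩
  M (suc s + a) + (M (suc s) + (Mfrom 1 s + Mfrom 2 s) + M s)
    ≡⟨ cong (M (suc s + a) +_) (M-suc-suc s) ⟨
  M (suc s + a) + M (suc (suc s))
    ≡⟨ cong (λ k → M (suc s + a) + M (suc k)) (+-comm 1 s) ⟩
  M (suc s + a) + M (suc s + 1) ∎

mainTheorem1 : (n r : ℕ) → 1 ≤ r → r < n →
    InRow (p n r) × (wt (p n r) + M r + M (r ∸ 1) ≡ M (n ∸ 1) + M (r + 1))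
mainTheorem1 (suc n) (suc s) _ (s≤s r≤n) with m≤n⇒∃[o]m+o≡n r≤n
... | a , refl =
  subst (λ w → InRow w × (wt w + M (suc s) + M s ≡ M (suc s + a) + M (suc s + 1)))
        (sym (p-closing s a))
        (closing-InRow a s , wt-closing-identity a s)
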